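{- Let $p$ be a prime, $n\ge 1$, $q=p^n$, and let $\gamma\in\mathbb{F}_q^*$ have multiplicative order $T$; put $G=\langle\gamma\rangle$. Let $(\beta_1,\ldots,\beta_n)$ be an ordered basis of $\mathbb{F}_q$ over $\mathbb{F}_p$ and let $P:G\to\mathbb{F}_q$ be the map $P(\gamma^x)=\xi_x$ for $x=0,1,\ldots,T-1$. Let $m$ be an integer with $0\le m\le T$ and $F:\mathbb{F}_q\to\mathbb{F}_q$ a map with $F(\zeta)=P(\zeta)$ for all but at most $m$ elements $\zeta\in G$. Suppose there exist an $\mathbb{F}_p$-linear subspace $U\le\mathbb{F}_q$ of codimension $k$, a linearised polynomial $M\in\mathbb{F}_q[X]$ and constants $a_V\in\mathbb{F}_q$ indexed by the cosets $V$ of $U$, such that $F(\zeta)=M(\zeta)+a_{U+\zeta}$ for all $\zeta\in\mathbb{F}_q$. If $\gcd(T,p-1)>1$, then $p^k\ge \frac{T-2m}{2^n}$.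
   Context: A linearised polynomial over $\mathbb{F}_q$ is one of the form $\sum_{j=0}^{n-1}c_jX^{p^j}$, $c_j\in\mathbb{F}_q$. For an integer $0\le x\le q-1$ with base-$p$ expansion $x=x_1+x_2p+\cdots+x_np^{n-1}$, $0\le x_i<p$, one sets $\xi_x=x_1\beta_1+\cdots+x_n\beta_n\in\mathbb{F}_q$. -}

module Defs where

open import Level using (0ℓ)
open import Data.Nat as ℕ using (ℕ; zero; suc; _∸_; _%_; _/_; _^_; NonZero)
open import Data.Fin using (Fin; toℕ)
import Data.Fin as Fin
open import Data.Product using (Σ; ∃; _×_; _,_)
open import Data.List using (List; length; filter; map)
open import Data.List.Base using (allFin)
open import Relation.Nullary using (¬_; Dec)
open import Relation.Nullary.Decidable using (¬?)
open import Relation.Binary.PropositionalEquality using (_≡_; _≢_)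
open import Relation.Binary.Definitions using (DecidableEquality)
open import Function.Bundles using (_↔_)
open import Data.Nat.Properties using (m^n≢0)
import Algebra.Structures as AS

times : {A : Set} → (A → A → A) → A → ℕ → A → A
times _+_ 0# zero    x = 0#
times _+_ 0# (suc k) x = x + times _+_ 0# k x

record FiniteField (p n : ℕ) : Set₁ where
  infixl 6 _+_
  infixl 7 _*_
  field
    Carrier : Set
    _+_ _*_ : Carrier → Carrier → Carrier
    -_      : Carrier → Carrier
    0# 1#   : Carrier
    isCommutativeRing : AS.IsCommutativeRing {A = Carrier} _≡_ _+_ _*_ -_ 0# 1#
    0≢1     : 0# ≢ 1#
    inverse : ∀ x → x ≢ 0# → ∃ λ y → x * y ≡ 1#
    _≟_     : DecidableEquality Carrier
    enum    : Carrier ↔ Fin (p ^ n)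
    char    : times _+_ 0# p 1# ≡ 0#

module FF {p n : ℕ} (𝔽 : FiniteField p n) where
  open FiniteField 𝔽 public

  infixr 7 _·_
  _·_ : ℕ → Carrier → Carrier
  _·_ = times _+_ 0#

  _^'_ : Carrier → ℕ → Carrier
  x ^' zero  = 1#
  x ^' suc k = x * (x ^' k)

  sumF : ∀ {d} → (Fin d → Carrier) → Carrier
  sumF {zero}  f = 0#
  sumF {suc d} f = f Fin.zero + sumF (λ i → f (Fin.suc i))

  -- F_p-linear combination  Σ c_i · v_i  with coefficients c_i ∈ {0,…,p-1} ≅ F_p
  lincomb : ∀ {d} → (Fin d → Fin p) → (Fin d → Carrier) → Carrier
  lincomb c v = sumF (λ i → toℕ (c i) · v i)

  Independent : ∀ {d} → (Fin d → Carrier) → Set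
  Independent v = ∀ c → lincomb c v ≡ 0# → ∀ i → toℕ (c i) ≡ 0

  IsBasis : (Fin n → Carrier) → Set
  IsBasis β = Independent β × (∀ ζ → ∃ λ c → ζ ≡ lincomb c β)

  HasOrder : Carrier → ℕ → Set
  HasOrder γ T = (1 ℕ.≤ T) × (γ ^' T ≡ 1#) × (∀ t → 1 ℕ.≤ t → t ℕ.< T → γ ^' t ≢ 1#)

  -- base-p digit x_i (i = 0..n-1) and ξ_x = x_1 β_1 + ⋯ + x_n β_n
  digit : .{{NonZero p}} → ℕ → Fin n → ℕ
  digit x i = ((x / (p ^ toℕ i)) {{m^n≢0 p (toℕ i)}}) % p

  ξ : .{{NonZero p}} → (Fin n → Carrier) → ℕ → Carrier
  ξ β x = sumF (λ i → digit x i · β i)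

  record Subspace (U : Carrier → Set) (d : ℕ) : Set where
    field
      zero∈ : U 0#
      +∈    : ∀ {x y} → U x → U y → U (x + y)
      ·∈    : ∀ k {x} → U x → U (k · x)
      basis : Fin d → Carrier
      basis∈ : ∀ i → U (basis i)
      basisIndep : Independent basis
      basisSpan  : ∀ ζ → U ζ → ∃ λ c → ζ ≡ lincomb c basis

  linearised : (Fin n → Carrier) → Carrier → Carrier
  linearised c ζ = sumF (λ j → c j * (ζ ^' (p ^ toℕ j)))

  mismatches : .{{NonZero p}} → (Fin n → Carrier) → Carrier → ℕ → (Carrier → Carrier) → ℕ
  mismatches β γ T F =
    length (filter (λ x → ¬? (F (γ ^' toℕ x) ≟ ξ β (toℕ x))) (allFin T))

-- Since gcd(T, p − 1) > 1, the prime field contains a T-th root of unity c ≠ 1.  It lies in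
-- G = ⟨γ⟩, say c = γˢ, and satisfies M(cζ) = c M(ζ) for the linearised M, because c^(pʲ) = c.
-- Call x ∈ [0, T) good when F agrees with P at γˣ and at cγˣ = γ^(x + s mod T); all but at
-- most 2m exponents are good.  For good x the quantity F(cγˣ) − c F(γˣ) = a(cγˣ) − c a(γˣ)
-- depends only on the coset γˣ + U, and it also equals ξ_(x+s mod T) − c ξₓ = (1 − c) ξₓ + Φ,
-- where Φ is determined by n bits: whether x + s wraps around T, and the carries into the
-- digits 1, …, n − 1 of the base-p addition.  Since c ≠ 1 and x ↦ ξₓ is injective, a good x
-- is determined by its coset and these bits, whence T − 2m ≤ 2ⁿ · |𝔽_q / U| = 2ⁿ pᵏ.

module Submission where

open import Defs

open import Level using (0ℓ)
open import Function using (_∘_)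
open import Function.Bundles using (Inverse; Injection)
open import Function.Properties.Inverse using (Inverse⇒Injection)
open import Data.Empty using (⊥-elim)
open import Data.Sum using (inj₁; inj₂)
open import Data.Product using (∃; _×_; _,_; proj₁; proj₂; uncurry)
open import Data.Product.Properties using (×-≡,≡→≡)
open import Data.Maybe using (nothing)
open import Relation.Nullary using (¬_; yes; no)
open import Relation.Nullary.Decidable using (¬?; decidable-stable)
open import Relation.Unary using (Pred; Decidable)
open import Relation.Unary.Properties using (∁?; _∩?_)
open import Relation.Binary.Definitions using (tri<; tri≈; tri>)
open import Relation.Binary.PropositionalEquality
  using (_≡_; _≢_; refl; sym; trans; cong; cong₂; subst; setoid; module ≡-Reasoning)

open import Data.Nat as ℕ using (ℕ; zero; suc; NonZero; _∸_; _^_; _≤_; _<_; _!; s≤s; z≤n)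
import Data.Nat.Properties as ℕₚ
open import Data.Nat.DivMod
  using (_%_; _/_; _mod_; m≡m%n+[m/n]*n; [m+kn]%n≡m%n; m<n⇒m%n≡m; m%n<n; m/n*n≡m; +-distrib-/-∣ʳ; m*n/n≡m;
         m<n*o⇒m/o<n; n/1≡n; n%1≡0; m/n/o≡m/[n*o])
open import Data.Nat.Divisibility using (_∣_; divides; ∣⇒≤; n∣m*n)
open import Data.Nat.GCD using (gcd; gcd[m,n]∣m; gcd[m,n]∣n; module Bézout)
open import Data.Nat.Coprimality using (coprime-Bézout; prime⇒coprime)
open import Data.Nat.Primality using (Prime; euclidsLemma; prime⇒nonZero; prime⇒nonTrivial)
open import Data.Nat.Combinatorics using (_C_; k![n∸k]!∣n!; nCn≡1)
open import Data.Nat.Combinatorics.Specification using (nCk≡n!/k![n-k]!)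
open import Data.Nat.Tactic.RingSolver using (solve-∀)

open import Data.Fin as Fin using (Fin; toℕ)
import Data.Fin.Properties as Finₚ
import Data.Vec.Functional as VF
open import Data.List as List using (List; []; _∷_; length; filter; lookup; allFin; map)
import Data.List.Properties as Listₚ
open import Data.List.Relation.Unary.All as All using (All; []; _∷_)
import Data.List.Relation.Unary.All.Properties as AllP
open import Data.List.Relation.Unary.Any as Any using ()
open import Data.List.Relation.Unary.AllPairs using ([]; _∷_)
open import Data.List.Relation.Unary.Unique.Propositional using (Unique)
import Data.List.Relation.Unary.Unique.Propositional.Properties as UniqP
open import Data.List.Membership.Propositional using (_∈_)
open import Data.List.Membership.Propositional.Properties
  using (∈-lookup; ∈-filter⁺; ∈-filter⁻; ∈-allFin; ∈-map⁻)
import Data.List.Membership.Setoid.Properties as Membershipₛ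

open import Algebra.Bundles using (CommutativeRing; Semiring)
open import Algebra.Structures using (IsCommutativeRing)
import Algebra.Properties.Ring as RingProperties
import Algebra.Properties.CommutativeSemiring.Binomial as Binomial
open import Tactic.RingSolver.Core.AlmostCommutativeRing using (fromCommutativeRing)

-- Arithmetic of natural numbers

prime>1 : ∀ {p} → Prime p → 1 < p
prime>1 {p} p-prime = ℕ.nonTrivial⇒n>1 p {{prime⇒nonTrivial p-prime}}

n∣n! : ∀ {n} → 0 < n → n ∣ n !
n∣n! {suc n} _ = divides (n !) (ℕₚ.*-comm (suc n) (n !))

prime∤! : ∀ {p} → Prime p → ∀ j → j < p → ¬ p ∣ j !
prime∤! p-prime zero    _   p∣1 = ℕₚ.<⇒≱ (prime>1 p-prime) (∣⇒≤ p∣1)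
prime∤! p-prime (suc j) j<p p∣j! with euclidsLemma (suc j) (j !) p-prime p∣j!
... | inj₁ p∣1+j = ℕₚ.<⇒≱ j<p (∣⇒≤ p∣1+j)
... | inj₂ p∣j!  = prime∤! p-prime j (ℕₚ.<-trans (ℕₚ.n<1+n j) j<p) p∣j!

nCk*k!*[n∸k]!≡n! : ∀ {n k} → k ≤ n → (n C k) ℕ.* (k ! ℕ.* (n ∸ k) !) ≡ n !
nCk*k!*[n∸k]!≡n! {n} {k} k≤n =
  trans (cong (ℕ._* (k ! ℕ.* (n ∸ k) !)) (nCk≡n!/k![n-k]! k≤n)) (m/n*n≡m (k![n∸k]!∣n! k≤n))
  where instance _ = ℕₚ._!*_!≢0 k (n ∸ k)

prime∣C : ∀ {p} → Prime p → ∀ k → 0 < k → k < p → p ∣ p C k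
prime∣C {p} p-prime k 0<k k<p
  with euclidsLemma (p C k) (k ! ℕ.* (p ∸ k) !) p-prime
         (subst (p ∣_) (sym (nCk*k!*[n∸k]!≡n! (ℕₚ.<⇒≤ k<p)))
           (n∣n! (ℕₚ.<-trans (s≤s z≤n) (prime>1 p-prime))))
... | inj₁ p∣C = p∣C
... | inj₂ p∣k![p∸k]! with euclidsLemma (k !) ((p ∸ k) !) p-prime p∣k![p∸k]!
...   | inj₁ p∣k!     = ⊥-elim (prime∤! p-prime k k<p p∣k!)
...   | inj₂ p∣[p∸k]! =
  ⊥-elim (prime∤! p-prime (p ∸ k) (ℕₚ.∸-monoʳ-< {p} {k} {0} 0<k (ℕₚ.<⇒≤ k<p)) p∣[p∸k]!)

[m+n]/o≡[m%o+n%o]/o+[m/o+n/o] : ∀ m n o .{{_ : NonZero o}} →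
  (m ℕ.+ n) / o ≡ (m % o ℕ.+ n % o) / o ℕ.+ (m / o ℕ.+ n / o)
[m+n]/o≡[m%o+n%o]/o+[m/o+n/o] m n o = begin
  (m ℕ.+ n) / o                                         ≡⟨ cong (_/ o) split ⟩
  (m % o ℕ.+ n % o ℕ.+ (m / o ℕ.+ n / o) ℕ.* o) / o     ≡⟨ +-distrib-/-∣ʳ (m % o ℕ.+ n % o) (n∣m*n (m / o ℕ.+ n / o)) ⟩
  (m % o ℕ.+ n % o) / o ℕ.+ (m / o ℕ.+ n / o) ℕ.* o / o
    ≡⟨ cong ((m % o ℕ.+ n % o) / o ℕ.+_) (m*n/n≡m (m / o ℕ.+ n / o) o) ⟩
  (m % o ℕ.+ n % o) / o ℕ.+ (m / o ℕ.+ n / o)           ∎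
  where
  open ≡-Reasoning
  regroup : ∀ a b c d o → (a ℕ.+ b ℕ.* o) ℕ.+ (c ℕ.+ d ℕ.* o) ≡ a ℕ.+ c ℕ.+ (b ℕ.+ d) ℕ.* o
  regroup = solve-∀
  split : m ℕ.+ n ≡ m % o ℕ.+ n % o ℕ.+ (m / o ℕ.+ n / o) ℕ.* o
  split = trans (cong₂ ℕ._+_ (m≡m%n+[m/n]*n m o) (m≡m%n+[m/n]*n n o)) (regroup (m % o) (m / o) (n % o) (n / o) o)

[m%o+n%o]/o<2 : ∀ m n o .{{_ : NonZero o}} → (m % o ℕ.+ n % o) / o < 2
[m%o+n%o]/o<2 m n o = m<n*o⇒m/o<n (ℕₚ.<-≤-trans (ℕₚ.+-mono-< (m%n<n m o) (m%n<n n o))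
  (ℕₚ.≤-reflexive (cong (o ℕ.+_) (sym (ℕₚ.+-identityʳ o)))))

[a+[p∸b]]%p≡0⇒a≡b : ∀ {p} .{{_ : NonZero p}} a b → a < p → b < p → (a ℕ.+ (p ∸ b)) % p ≡ 0 → a ≡ b
[a+[p∸b]]%p≡0⇒a≡b {p} a b a<p b<p ≡0 with ℕₚ.≤-total b a
... | inj₁ b≤a = ℕₚ.≤-antisym (ℕₚ.m∸n≡0⇒m≤n a∸b≡0) b≤a
  where
  open ≡-Reasoning
  a∸b≡0 : a ∸ b ≡ 0
  a∸b≡0 = begin
    a ∸ b                     ≡⟨ m<n⇒m%n≡m (ℕₚ.≤-<-trans (ℕₚ.m∸n≤m a b) a<p) ⟨
    (a ∸ b) % p               ≡⟨ [m+kn]%n≡m%n (a ∸ b) 1 p ⟨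
    ((a ∸ b) ℕ.+ 1 ℕ.* p) % p ≡⟨ cong (λ z → ((a ∸ b) ℕ.+ z) % p) (ℕₚ.*-identityˡ p) ⟩
    ((a ∸ b) ℕ.+ p) % p       ≡⟨ cong (_% p) (ℕₚ.+-∸-comm p b≤a) ⟨
    (a ℕ.+ p ∸ b) % p         ≡⟨ cong (_% p) (ℕₚ.+-∸-assoc a (ℕₚ.<⇒≤ b<p)) ⟩
    (a ℕ.+ (p ∸ b)) % p       ≡⟨ ≡0 ⟩
    0                         ∎
... | inj₂ a≤b with ℕₚ.m≤n⇒m<n∨m≡n a≤b
...   | inj₂ a≡b = a≡b
...   | inj₁ a<b =
  ⊥-elim (ℕₚ.<⇒≱ b<p (ℕₚ.m∸n≡0⇒m≤n (ℕₚ.m+n≡0⇒n≡0 a (trans (sym (m<n⇒m%n≡m small)) ≡0))))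
  where
  small : a ℕ.+ (p ∸ b) < p
  small = ℕₚ.<-≤-trans (ℕₚ.+-monoˡ-< (p ∸ b) a<b) (ℕₚ.≤-reflexive (ℕₚ.m+[n∸m]≡n (ℕₚ.<⇒≤ b<p)))

-- Counting

count : {A : Set} {P : Pred A 0ℓ} → Decidable P → List A → ℕ
count P? xs = length (filter P? xs)

module _ {A : Set} {P Q : Pred A 0ℓ} (P? : Decidable P) (Q? : Decidable Q) where
  count-cover : ∀ xs → length xs ≤ count (∁? P?) xs ℕ.+ (count (∁? Q?) xs ℕ.+ count (P? ∩? Q?) xs)
  count-cover []       = z≤n
  count-cover (x ∷ xs) with P? x | Q? x | count-cover xs
  ... | no  _ | yes _ | ih = s≤s ih
  ... | no  _ | no  _ | ih = s≤s (ℕₚ.≤-trans ih (ℕₚ.+-monoʳ-≤ (count (∁? P?) xs) (ℕₚ.n≤1+n _)))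
  ... | yes _ | no  _ | ih = ℕₚ.≤-trans (s≤s ih) (ℕₚ.≤-reflexive (sym (ℕₚ.+-suc (count (∁? P?) xs) _)))
  ... | yes _ | yes _ | ih = ℕₚ.≤-trans (s≤s ih) (ℕₚ.≤-reflexive (sym (trans (cong (count (∁? P?) xs ℕ.+_)
                               (ℕₚ.+-suc (count (∁? Q?) xs) _)) (ℕₚ.+-suc (count (∁? P?) xs) _))))

module _ {A : Set} where
  lookup-injective : ∀ {xs : List A} → Unique xs → ∀ {i j} → lookup xs i ≡ lookup xs j → i ≡ j
  lookup-injective (_ ∷ _)    {Fin.zero}  {Fin.zero}  _  = refl
  lookup-injective (x∉xs ∷ _) {Fin.zero}  {Fin.suc j} eq = ⊥-elim (All.lookup x∉xs (∈-lookup j) eq)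
  lookup-injective (x∉xs ∷ _) {Fin.suc i} {Fin.zero}  eq = ⊥-elim (All.lookup x∉xs (∈-lookup i) (sym eq))
  lookup-injective (_ ∷ uniq) {Fin.suc i} {Fin.suc j} eq = cong Fin.suc (lookup-injective uniq eq)

  unique-⊆⇒length≤ : ∀ {xs ys : List A} → Unique xs → (∀ {x} → x ∈ xs → x ∈ ys) →
    length xs ≤ length ys
  unique-⊆⇒length≤ {xs} uniq xs⊆ys = Finₚ.injective⇒≤ {f = λ i → Any.index (xs⊆ys (∈-lookup i))} λ eq →
    lookup-injective uniq (Membershipₛ.index-injective (setoid A) (xs⊆ys (∈-lookup _)) (xs⊆ys (∈-lookup _)) eq)

module _ {T : ℕ} {P : Pred (Fin T) 0ℓ} (P? : Decidable P) where
  count-∘-injective≤ : (σ : Fin T → Fin T) → (∀ {i j} → σ i ≡ σ j → i ≡ j) →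
    count (P? ∘ σ) (allFin T) ≤ count P? (allFin T)
  count-∘-injective≤ σ σ-injective =
    subst (_≤ count P? (allFin T)) (Listₚ.length-map σ (filter (P? ∘ σ) (allFin T)))
    (unique-⊆⇒length≤ (UniqP.map⁺ σ-injective (UniqP.filter⁺ (P? ∘ σ) (UniqP.allFin⁺ T))) σ[xs]⊆)
    where
    σ[xs]⊆ : ∀ {j} → j ∈ map σ (filter (P? ∘ σ) (allFin T)) → j ∈ filter P? (allFin T)
    σ[xs]⊆ j∈ with ∈-map⁻ σ j∈
    ... | i , i∈ , refl = ∈-filter⁺ P? (∈-allFin (σ i)) (proj₂ (∈-filter⁻ (P? ∘ σ) {xs = allFin T} i∈))

  count*K≤N : ∀ {K N} (f : Fin T → Fin K → Fin N) →
    (∀ {x y i j} → P x → P y → f x i ≡ f y j → x ≡ y × i ≡ j) → count P? (allFin T) ℕ.* K ≤ N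
  count*K≤N {K} f f-injective = Finₚ.injective⇒≤ {f = h} h-injective
    where
    xs = filter P? (allFin T)
    h : Fin (length xs ℕ.* K) → Fin _
    h k = uncurry (λ a b → f (lookup xs a) b) (Fin.remQuot K k)
    h-injective : ∀ {k l} → h k ≡ h l → k ≡ l
    h-injective {k} {l} eq = begin
      k                                                 ≡⟨ Finₚ.combine-remQuot {length xs} K k ⟨
      uncurry Fin.combine (Fin.remQuot {length xs} K k)
        ≡⟨ cong (uncurry Fin.combine) (×-≡,≡→≡ (lookup-injective uniq x≡y , i≡j)) ⟩
      uncurry Fin.combine (Fin.remQuot {length xs} K l) ≡⟨ Finₚ.combine-remQuot {length xs} K l ⟩
      l                                                 ∎
      where
      open ≡-Reasoning
      uniq = UniqP.filter⁺ P? (UniqP.allFin⁺ T)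
      P[lookup] : ∀ a → P (lookup xs a)
      P[lookup] a = All.lookup (AllP.all-filter P? (allFin T)) (∈-lookup a)
      x≡y×i≡j = f-injective (P[lookup] _) (P[lookup] _) eq
      x≡y = proj₁ x≡y×i≡j
      i≡j = proj₂ x≡y×i≡j

-- Base-p digits and carries

module Digits (p : ℕ) .{{_ : NonZero p}} where

  digit : ℕ → ℕ → ℕ
  digit x i = ((x / p ^ i) {{ℕₚ.m^n≢0 p i}}) % p

  carry : ℕ → ℕ → ℕ → ℕ
  carry y t i = let instance _ = ℕₚ.m^n≢0 p i in (y % p ^ i ℕ.+ t % p ^ i) / p ^ i

  digit<p : ∀ x i → digit x i < p
  digit<p x i = m%n<n _ p

  carry<2 : ∀ y t i → carry y t i < 2
  carry<2 y t i = [m%o+n%o]/o<2 y t (p ^ i) {{ℕₚ.m^n≢0 p i}}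

  carry-0 : ∀ y t → carry y t 0 ≡ 0
  carry-0 y t = trans (n/1≡n _) (cong₂ ℕ._+_ (n%1≡0 y) (n%1≡0 t))

  [y+t]/pⁱ≡carry+[y/pⁱ+t/pⁱ] : ∀ y t i → let instance _ = ℕₚ.m^n≢0 p i in
    (y ℕ.+ t) / p ^ i ≡ carry y t i ℕ.+ (y / p ^ i ℕ.+ t / p ^ i)
  [y+t]/pⁱ≡carry+[y/pⁱ+t/pⁱ] y t i = [m+n]/o≡[m%o+n%o]/o+[m/o+n/o] y t (p ^ i) {{ℕₚ.m^n≢0 p i}}

  digit-/p : ∀ x i → digit (x / p) i ≡ digit x (suc i)
  digit-/p x i = cong (_% p) (m/n/o≡m/[n*o] x p (p ^ i) {{_}} {{ℕₚ.m^n≢0 p i}} {{ℕₚ.m^n≢0 p (suc i)}})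

  digits-injective : ∀ d {x y} → x < p ^ d → y < p ^ d →
    (∀ (i : Fin d) → digit x (toℕ i) ≡ digit y (toℕ i)) → x ≡ y
  digits-injective zero    {zero} {zero} _       _       _ = refl
  digits-injective zero    {suc _}       (s≤s ()) _       _
  digits-injective zero    {y = suc _}   _       (s≤s ()) _
  digits-injective (suc d) {x} {y} x<pᵈ⁺¹ y<pᵈ⁺¹ same = begin
    x                     ≡⟨ m≡m%n+[m/n]*n x p ⟩
    x % p ℕ.+ x / p ℕ.* p ≡⟨ cong₂ (λ r q → r ℕ.+ q ℕ.* p) last-digit higher-digits ⟩
    y % p ℕ.+ y / p ℕ.* p ≡⟨ m≡m%n+[m/n]*n y p ⟨
    y                     ∎
    where
    open ≡-Reasoning
    last-digit : x % p ≡ y % p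
    last-digit = trans (cong (_% p) (sym (n/1≡n x))) (trans (same Fin.zero) (cong (_% p) (n/1≡n y)))
    /p< : ∀ {z} → z < p ^ suc d → z / p < p ^ d
    /p< {z} z< = m<n*o⇒m/o<n (subst (z <_) (ℕₚ.*-comm p (p ^ d)) z<)
    higher-digits : x / p ≡ y / p
    higher-digits = digits-injective d (/p< x<pᵈ⁺¹) (/p< y<pᵈ⁺¹)
      (λ i → trans (digit-/p x (toℕ i)) (trans (same (Fin.suc i)) (sym (digit-/p y (toℕ i)))))

module FieldProperties {p n : ℕ} (𝔽 : FiniteField p n) where
  open FF 𝔽 public hiding (digit; ξ)
  open IsCommutativeRing isCommutativeRing public
    using (+-assoc; +-comm; *-assoc; *-comm; distribˡ; distribʳ; +-identityˡ; +-identityʳ;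
           *-identityˡ; *-identityʳ; -‿inverseˡ; -‿inverseʳ; zeroˡ; zeroʳ)
  open ≡-Reasoning

  commutativeRing : CommutativeRing _ _
  commutativeRing = record { isCommutativeRing = isCommutativeRing }

  open RingProperties (CommutativeRing.ring commutativeRing) public
    using (+-cancelˡ; +-cancelʳ; +-inverseʳ-unique; -‿+-comm; -‿distribˡ-*; x∙y⁻¹≈ε⇒x≈y; x≈z//y;
           x[y-z]≈xy-xz)
  open import Tactic.RingSolver.NonReflective (fromCommutativeRing commutativeRing (λ _ → nothing)) public
    using (solve; _⊜_; _⊕_; _⊗_)

  enum-injective : ∀ {x y} → Inverse.to enum x ≡ Inverse.to enum y → x ≡ y
  enum-injective = Injection.injective (Inverse⇒Injection enum)

  1≢0 : 1# ≢ 0#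
  1≢0 1≡0 = 0≢1 (sym 1≡0)

  *-cancelˡ : ∀ a {x y} → a ≢ 0# → a * x ≡ a * y → x ≡ y
  *-cancelˡ a {x} {y} a≢0 ax≡ay with inverse a a≢0
  ... | a⁻¹ , aa⁻¹≡1 = begin
    x              ≡⟨ *-identityˡ x ⟨
    1# * x         ≡⟨ cong (_* x) (trans (sym aa⁻¹≡1) (*-comm a a⁻¹)) ⟩
    a⁻¹ * a * x    ≡⟨ *-assoc a⁻¹ a x ⟩
    a⁻¹ * (a * x)  ≡⟨ cong (a⁻¹ *_) ax≡ay ⟩
    a⁻¹ * (a * y)  ≡⟨ *-assoc a⁻¹ a y ⟨
    a⁻¹ * a * y    ≡⟨ cong (_* y) (trans (*-comm a⁻¹ a) aa⁻¹≡1) ⟩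
    1# * y         ≡⟨ *-identityˡ y ⟩
    y              ∎

  x-y≡0⇒x≡y : ∀ {x y} → x + - y ≡ 0# → x ≡ y
  x-y≡0⇒x≡y = x∙y⁻¹≈ε⇒x≈y _ _

  x≡y+z⇒y≡x-z : ∀ {x y z} → x ≡ y + z → y ≡ x + - z
  x≡y+z⇒y≡x-z {x} {y} {z} x≡y+z = x≈z//y y z x (sym x≡y+z)

  x+u≡y+w⇒x-y≡w-u : ∀ {x u y w} → x + u ≡ y + w → x + - y ≡ w + - u
  x+u≡y+w⇒x-y≡w-u {x} {u} {y} {w} eq = begin
    x + - y                   ≡⟨ cong (_+ - y) (x≈z//y x u (y + w) eq) ⟩
    y + w + - u + - y
      ≡⟨ solve 4 (λ y w nu ny → (((y ⊕ w) ⊕ nu) ⊕ ny) ⊜ ((w ⊕ nu) ⊕ (y ⊕ ny))) refl y w (- u) (- y) ⟩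
    (w + - u) + (y + - y)     ≡⟨ cong ((w + - u) +_) (-‿inverseʳ y) ⟩
    (w + - u) + 0#            ≡⟨ +-identityʳ _ ⟩
    w + - u                   ∎

  ^'-homo-* : ∀ x a b → x ^' (a ℕ.+ b) ≡ x ^' a * x ^' b
  ^'-homo-* x zero    b = sym (*-identityˡ _)
  ^'-homo-* x (suc a) b = trans (cong (x *_) (^'-homo-* x a b)) (sym (*-assoc x _ _))

  ^'-assocʳ : ∀ x a b → (x ^' a) ^' b ≡ x ^' (a ℕ.* b)
  ^'-assocʳ x a zero    = cong (x ^'_) (sym (ℕₚ.*-zeroʳ a))
  ^'-assocʳ x a (suc b) = begin
    x ^' a * (x ^' a) ^' b      ≡⟨ cong (x ^' a *_) (^'-assocʳ x a b) ⟩
    x ^' a * x ^' (a ℕ.* b)     ≡⟨ ^'-homo-* x a (a ℕ.* b) ⟨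
    x ^' (a ℕ.+ a ℕ.* b)        ≡⟨ cong (x ^'_) (ℕₚ.*-suc a b) ⟨
    x ^' (a ℕ.* suc b)          ∎

  ^'-distrib-* : ∀ x y a → (x * y) ^' a ≡ x ^' a * y ^' a
  ^'-distrib-* x y zero    = sym (*-identityˡ 1#)
  ^'-distrib-* x y (suc a) = trans (cong ((x * y) *_) (^'-distrib-* x y a))
    (solve 4 (λ x y u v → ((x ⊗ y) ⊗ (u ⊗ v)) ⊜ ((x ⊗ u) ⊗ (y ⊗ v))) refl x y (x ^' a) (y ^' a))

  1^'a≡1 : ∀ a → 1# ^' a ≡ 1#
  1^'a≡1 zero    = refl
  1^'a≡1 (suc a) = trans (*-identityˡ _) (1^'a≡1 a)

  ·-homo-+ : ∀ a b x → (a ℕ.+ b) · x ≡ a · x + b · x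
  ·-homo-+ zero    b x = sym (+-identityˡ _)
  ·-homo-+ (suc a) b x = trans (cong (x +_) (·-homo-+ a b x)) (sym (+-assoc x _ _))

  ·-zeroʳ : ∀ a → a · 0# ≡ 0#
  ·-zeroʳ zero    = refl
  ·-zeroʳ (suc a) = trans (+-identityˡ _) (·-zeroʳ a)

  ·-assoc : ∀ a b x → (a ℕ.* b) · x ≡ a · (b · x)
  ·-assoc zero    b x = refl
  ·-assoc (suc a) b x = trans (·-homo-+ b (a ℕ.* b) x) (cong (b · x +_) (·-assoc a b x))

  ·-*-assoc : ∀ a x y → a · (x * y) ≡ (a · x) * y
  ·-*-assoc zero    x y = sym (zeroˡ y)
  ·-*-assoc (suc a) x y = trans (cong (x * y +_) (·-*-assoc a x y)) (sym (distribʳ y x (a · x)))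

  [q*a]·x≡0 : ∀ q {a x} → a · x ≡ 0# → (q ℕ.* a) · x ≡ 0#
  [q*a]·x≡0 q {a} {x} a·x≡0 = trans (·-assoc q a x) (trans (cong (q ·_) a·x≡0) (·-zeroʳ q))

  ·≡·1* : ∀ a x → a · x ≡ (a · 1#) * x
  ·≡·1* a x = trans (cong (a ·_) (sym (*-identityˡ x))) (·-*-assoc a 1# x)

  ·1-homo-* : ∀ a b → (a ℕ.* b) · 1# ≡ (a · 1#) * (b · 1#)
  ·1-homo-* a b = trans (·-assoc a b 1#) (·≡·1* a (b · 1#))

  ·1-homo-^ : ∀ a k → (a ^ k) · 1# ≡ (a · 1#) ^' k
  ·1-homo-^ a zero    = +-identityʳ 1#
  ·1-homo-^ a (suc k) = trans (·1-homo-* a (a ^ k)) (cong ((a · 1#) *_) (·1-homo-^ a k))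

  sumF-cong : ∀ {d} {f g : Fin d → Carrier} → (∀ i → f i ≡ g i) → sumF f ≡ sumF g
  sumF-cong {zero}  f≗g = refl
  sumF-cong {suc d} f≗g = cong₂ _+_ (f≗g Fin.zero) (sumF-cong (λ i → f≗g (Fin.suc i)))

  sumF-0 : ∀ d → sumF {d} (λ _ → 0#) ≡ 0#
  sumF-0 zero    = refl
  sumF-0 (suc d) = trans (+-identityˡ _) (sumF-0 d)

  sumF-homo-+ : ∀ {d} (f g : Fin d → Carrier) → sumF (λ i → f i + g i) ≡ sumF f + sumF g
  sumF-homo-+ {zero}  f g = sym (+-identityʳ 0#)
  sumF-homo-+ {suc d} f g = trans (cong (f Fin.zero + g Fin.zero +_) (sumF-homo-+ (f ∘ Fin.suc) (g ∘ Fin.suc)))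
    (solve 4 (λ a b c d → ((a ⊕ b) ⊕ (c ⊕ d)) ⊜ ((a ⊕ c) ⊕ (b ⊕ d))) refl _ _ _ _)

  sumF-neg : ∀ {d} (f : Fin d → Carrier) → sumF (λ i → - f i) ≡ - sumF f
  sumF-neg {d} f = +-inverseʳ-unique (sumF f) _
    (trans (sym (sumF-homo-+ f (λ i → - f i))) (trans (sumF-cong (λ i → -‿inverseʳ (f i))) (sumF-0 d)))

  sumF-last : ∀ m (h : Fin (suc m) → Carrier) → (∀ i → h (Fin.inject₁ i) ≡ 0#) → sumF h ≡ h (Fin.fromℕ m)
  sumF-last zero    h _          = +-identityʳ _
  sumF-last (suc m) h h[inj]≡0 = trans (cong (_+ sumF (h ∘ Fin.suc)) (h[inj]≡0 Fin.zero))
    (trans (+-identityˡ _) (sumF-last m (h ∘ Fin.suc) (h[inj]≡0 ∘ Fin.suc)))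

  *-distribˡ-sumF : ∀ {d} c (f : Fin d → Carrier) → c * sumF f ≡ sumF (λ i → c * f i)
  *-distribˡ-sumF {zero}  c f = zeroʳ c
  *-distribˡ-sumF {suc d} c f = trans (distribˡ c _ _) (cong (c * f Fin.zero +_) (*-distribˡ-sumF c (f ∘ Fin.suc)))

module PrimeSubfield {p n : ℕ} (𝔽 : FiniteField p n) (p-prime : Prime p) where
  open FieldProperties 𝔽 public
  open ≡-Reasoning

  instance
    p≢0 : NonZero p
    p≢0 = prime⇒nonZero p-prime

  p·x≡0 : ∀ x → p · x ≡ 0#
  p·x≡0 x = trans (·≡·1* p x) (trans (cong (_* x) char) (zeroˡ x))

  ·-mod : ∀ a x → a · x ≡ (a % p) · x
  ·-mod a x = begin
    a · x                              ≡⟨ cong (_· x) (m≡m%n+[m/n]*n a p) ⟩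
    (a % p ℕ.+ a / p ℕ.* p) · x        ≡⟨ ·-homo-+ (a % p) _ x ⟩
    (a % p) · x + (a / p ℕ.* p) · x    ≡⟨ cong ((a % p) · x +_) ([q*a]·x≡0 (a / p) (p·x≡0 x)) ⟩
    (a % p) · x + 0#                   ≡⟨ +-identityʳ _ ⟩
    (a % p) · x                        ∎

  -[a·x]≡[p∸a]·x : ∀ a x → a ≤ p → - (a · x) ≡ (p ∸ a) · x
  -[a·x]≡[p∸a]·x a x a≤p = sym (+-inverseʳ-unique (a · x) ((p ∸ a) · x)
    (trans (sym (·-homo-+ a (p ∸ a) x)) (trans (cong (_· x) (ℕₚ.m+[n∸m]≡n a≤p)) (p·x≡0 x))))

  u·1≡0⇒[1+u]·1≢0 : ∀ u → u · 1# ≡ 0# → (1 ℕ.+ u) · 1# ≢ 0#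
  u·1≡0⇒[1+u]·1≢0 u u·1≡0 [1+u]·1≡0 = 1≢0 (begin
    1#                ≡⟨ +-identityʳ 1# ⟨
    1 · 1#            ≡⟨ +-identityʳ _ ⟨
    1 · 1# + 0#       ≡⟨ cong (1 · 1# +_) u·1≡0 ⟨
    1 · 1# + u · 1#   ≡⟨ ·-homo-+ 1 u 1# ⟨
    (1 ℕ.+ u) · 1#    ≡⟨ [1+u]·1≡0 ⟩
    0#                ∎)

  a·1≢0 : ∀ a → 0 < a → a < p → a · 1# ≢ 0#
  a·1≢0 a 0<a a<p a·1≡0 with coprime-Bézout (prime⇒coprime p-prime {{ℕ.>-nonZero 0<a}} a<p)
  ... | Bézout.+- x y 1+ya≡xp = u·1≡0⇒[1+u]·1≢0 (y ℕ.* a) ([q*a]·x≡0 y a·1≡0)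
                                  (trans (cong (_· 1#) 1+ya≡xp) ([q*a]·x≡0 x (p·x≡0 1#)))
  ... | Bézout.-+ x y 1+xp≡ya = u·1≡0⇒[1+u]·1≢0 (x ℕ.* p) ([q*a]·x≡0 x (p·x≡0 1#))
                                  (trans (cong (_· 1#) 1+xp≡ya) ([q*a]·x≡0 y a·1≡0))

  a<b⇒a·1≢b·1 : ∀ {a b} → a < b → b < p → a · 1# ≢ b · 1#
  a<b⇒a·1≢b·1 {a} {b} a<b b<p a·1≡b·1 =
    a·1≢0 (b ∸ a) (ℕₚ.m<n⇒0<n∸m a<b) (ℕₚ.≤-<-trans (ℕₚ.m∸n≤m b a) b<p)
      (+-cancelˡ (a · 1#) _ _ (begin
      a · 1# + (b ∸ a) · 1#   ≡⟨ ·-homo-+ a (b ∸ a) 1# ⟨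
      (a ℕ.+ (b ∸ a)) · 1#    ≡⟨ cong (_· 1#) (ℕₚ.m+[n∸m]≡n (ℕₚ.<⇒≤ a<b)) ⟩
      b · 1#                  ≡⟨ a·1≡b·1 ⟨
      a · 1#                  ≡⟨ +-identityʳ _ ⟨
      a · 1# + 0#             ∎))

  ·1-injective : ∀ {a b} → a < p → b < p → a · 1# ≡ b · 1# → a ≡ b
  ·1-injective {a} {b} a<p b<p a·1≡b·1 with ℕₚ.<-cmp a b
  ... | tri< a<b _ _ = ⊥-elim (a<b⇒a·1≢b·1 a<b b<p a·1≡b·1)
  ... | tri≈ _ a≡b _ = a≡b
  ... | tri> _ _ b<a = ⊥-elim (a<b⇒a·1≢b·1 b<a a<p (sym a·1≡b·1))

  p∣a⇒a·x≡0 : ∀ {a} x → p ∣ a → a · x ≡ 0#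
  p∣a⇒a·x≡0 x (divides q refl) = [q*a]·x≡0 q (p·x≡0 x)

  frobenius-+ : ∀ x y → (x + y) ^' p ≡ x ^' p + y ^' p
  frobenius-+ x y = subst (λ q → (x + y) ^' q ≡ x ^' q + y ^' q) (ℕₚ.suc-pred p)
    (frobenius-suc (ℕ.pred p) (ℕₚ.suc-pred p))
    where
    open Binomial (CommutativeRing.commutativeSemiring commutativeRing)
      using (binomialTerm; binomialExpansion; theorem)
    open import Algebra.Definitions.RawSemiring (Semiring.rawSemiring (CommutativeRing.semiring commutativeRing))
      using () renaming (_^_ to _^ᴿ_; _×_ to _×ᴿ_)

    ^≡^' : ∀ z k → z ^ᴿ k ≡ z ^' k
    ^≡^' z zero    = refl
    ^≡^' z (suc k) = cong (z *_) (^≡^' z k)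

    ×≡· : ∀ k z → k ×ᴿ z ≡ k · z
    ×≡· zero    z = refl
    ×≡· (suc k) z = cong (z +_) (×≡· k z)

    foldr≡sumF : ∀ {d} (f : Fin d → Carrier) → VF.foldr _+_ 0# f ≡ sumF f
    foldr≡sumF {zero}  f = refl
    foldr≡sumF {suc d} f = cong (f Fin.zero +_) (foldr≡sumF (f ∘ Fin.suc))

    frobenius-suc : ∀ m → suc m ≡ p → (x + y) ^' suc m ≡ x ^' suc m + y ^' suc m
    frobenius-suc m 1+m≡p = begin
      (x + y) ^' suc m                          ≡⟨ ^≡^' (x + y) (suc m) ⟨
      (x + y) ^ᴿ suc m                          ≡⟨ theorem (suc m) x y ⟩
      binomialExpansion x y (suc m)             ≡⟨ foldr≡sumF term ⟩
      term Fin.zero + sumF (term ∘ Fin.suc)     ≡⟨ cong₂ _+_ first-term (sumF-last m (term ∘ Fin.suc) middle-term) ⟩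
      y ^' suc m + term (Fin.suc (Fin.fromℕ m)) ≡⟨ cong (y ^' suc m +_) last-term ⟩
      y ^' suc m + x ^' suc m                   ≡⟨ +-comm _ _ ⟩
      x ^' suc m + y ^' suc m                   ∎
      where
      term : Fin (suc (suc m)) → Carrier
      term = binomialTerm x y (suc m)
      term≡ : ∀ k → term k ≡ (suc m C toℕ k) · (x ^' toℕ k * y ^' (suc m ∸ toℕ k))
      term≡ k = trans (×≡· (suc m C toℕ k) _)
        (cong ((suc m C toℕ k) ·_) (cong₂ _*_ (^≡^' x (toℕ k)) (^≡^' y (suc m ∸ toℕ k))))
      first-term : term Fin.zero ≡ y ^' suc m
      first-term = trans (term≡ Fin.zero) (trans (+-identityʳ _) (*-identityˡ _))
      last-term : term (Fin.suc (Fin.fromℕ m)) ≡ x ^' suc m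
      last-term = begin
        term (Fin.suc (Fin.fromℕ m))                    ≡⟨ term≡ (Fin.suc (Fin.fromℕ m)) ⟩
        (suc m C suc i) · (x ^' suc i * y ^' (m ∸ i))
          ≡⟨ cong (λ j → (suc m C suc j) · (x ^' suc j * y ^' (m ∸ j))) (Finₚ.toℕ-fromℕ m) ⟩
        (suc m C suc m) · (x ^' suc m * y ^' (m ∸ m))   ≡⟨ cong (_· (x ^' suc m * y ^' (m ∸ m))) (nCn≡1 (suc m)) ⟩
        1 · (x ^' suc m * y ^' (m ∸ m))                 ≡⟨ +-identityʳ _ ⟩
        x ^' suc m * y ^' (m ∸ m)                       ≡⟨ cong (λ j → x ^' suc m * y ^' j) (ℕₚ.n∸n≡0 m) ⟩
        x ^' suc m * 1#                                 ≡⟨ *-identityʳ _ ⟩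
        x ^' suc m                                      ∎
        where i = toℕ (Fin.fromℕ m)
      middle-term : ∀ i → term (Fin.suc (Fin.inject₁ i)) ≡ 0#
      middle-term i = trans (term≡ (Fin.suc (Fin.inject₁ i))) (p∣a⇒a·x≡0 _ (subst (λ q → p ∣ q C suc j) (sym 1+m≡p)
        (prime∣C p-prime (suc j) (s≤s z≤n) (subst (suc j <_) 1+m≡p (s≤s j<m)))))
        where
        j = toℕ (Fin.inject₁ i)
        j<m : j < m
        j<m = subst (_< m) (sym (Finₚ.toℕ-inject₁ i)) (Finₚ.toℕ<n i)

  fermat : ∀ r → (r · 1#) ^' p ≡ r · 1#
  fermat zero    = trans (cong (0# ^'_) (sym (ℕₚ.suc-pred p))) (zeroˡ _)
  fermat (suc r) = begin
    (1# + r · 1#) ^' p         ≡⟨ frobenius-+ 1# (r · 1#) ⟩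
    1# ^' p + (r · 1#) ^' p    ≡⟨ cong₂ _+_ (1^'a≡1 p) (fermat r) ⟩
    1# + r · 1#                ∎

  [r·1]^pʲ≡r·1 : ∀ r j → (r · 1#) ^' (p ^ j) ≡ r · 1#
  [r·1]^pʲ≡r·1 r zero    = *-identityʳ _
  [r·1]^pʲ≡r·1 r (suc j) = begin
    (r · 1#) ^' (p ℕ.* p ^ j)     ≡⟨ ^'-assocʳ (r · 1#) p (p ^ j) ⟨
    ((r · 1#) ^' p) ^' (p ^ j)    ≡⟨ cong (_^' (p ^ j)) (fermat r) ⟩
    (r · 1#) ^' (p ^ j)           ≡⟨ [r·1]^pʲ≡r·1 r j ⟩
    r · 1#                        ∎

  linearised-homogeneous : ∀ M r ζ → linearised M ((r · 1#) * ζ) ≡ (r · 1#) * linearised M ζ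
  linearised-homogeneous M r ζ = trans (sumF-cong term) (sym (*-distribˡ-sumF c (λ j → M j * ζ ^' (p ^ toℕ j))))
    where
    c = r · 1#
    term : ∀ j → M j * (c * ζ) ^' (p ^ toℕ j) ≡ c * (M j * ζ ^' (p ^ toℕ j))
    term j = begin
      M j * (c * ζ) ^' pʲ           ≡⟨ cong (M j *_) (^'-distrib-* c ζ pʲ) ⟩
      M j * (c ^' pʲ * ζ ^' pʲ)     ≡⟨ cong (λ z → M j * (z * ζ ^' pʲ)) ([r·1]^pʲ≡r·1 r (toℕ j)) ⟩
      M j * (c * ζ ^' pʲ)           ≡⟨ solve 3 (λ m c z → (m ⊗ (c ⊗ z)) ⊜ (c ⊗ (m ⊗ z))) refl (M j) c (ζ ^' pʲ) ⟩
      c * (M j * ζ ^' pʲ)           ∎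
      where pʲ = p ^ toℕ j

module Polynomials {p n : ℕ} (𝔽 : FiniteField p n) where
  open FieldProperties 𝔽
  open ≡-Reasoning

  -- Polynomials are coefficient lists, constant term first.
  eval : List Carrier → Carrier → Carrier
  eval []      x = 0#
  eval (c ∷ f) x = c + x * eval f x

  IsZero : List Carrier → Set
  IsZero = All (_≡ 0#)

  c+x*0≡c : ∀ c x → c + x * 0# ≡ c
  c+x*0≡c c x = trans (cong (c +_) (zeroʳ x)) (+-identityʳ c)

  -- Synthetic division by X − r.
  quotient : List Carrier → Carrier → List Carrier
  quotient []                r = []
  quotient (c ∷ [])          r = []
  quotient (c ∷ f@(_ ∷ _))   r = eval f r ∷ quotient f r

  length-quotient : ∀ f r → length (quotient f r) ≡ ℕ.pred (length f)
  length-quotient []              r = refl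
  length-quotient (c ∷ [])        r = refl
  length-quotient (c ∷ f@(_ ∷ _)) r = cong suc (length-quotient f r)

  eval-quotient : ∀ f r s → eval f s ≡ (s + - r) * eval (quotient f r) s + eval f r
  eval-quotient []              r s = sym (trans (cong (_+ 0#) (zeroʳ _)) (+-identityʳ 0#))
  eval-quotient (c ∷ [])        r s = begin
    c + s * 0#                     ≡⟨ c+x*0≡c c s ⟩
    c                              ≡⟨ trans (cong₂ _+_ (zeroʳ _) (c+x*0≡c c r)) (+-identityˡ c) ⟨
    (s + - r) * 0# + (c + r * 0#)  ∎
  eval-quotient (c ∷ f@(_ ∷ _)) r s = begin
    c + s * eval f s                  ≡⟨ cong (λ z → c + z * eval f s) s≡[s-r]+r ⟩
    c + (d + r) * eval f s            ≡⟨ cong (λ z → c + (d + r) * z) (eval-quotient f r s) ⟩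
    c + (d + r) * (d * Q + R)         ≡⟨ solve 5 (λ c d r Q R → (c ⊕ (d ⊕ r) ⊗ (d ⊗ Q ⊕ R))
                                                  ⊜ (d ⊗ (R ⊕ (d ⊕ r) ⊗ Q) ⊕ (c ⊕ r ⊗ R))) refl c d r Q R ⟩
    d * (R + (d + r) * Q) + (c + r * R) ≡⟨ cong (λ z → d * (R + z * Q) + (c + r * R)) s≡[s-r]+r ⟨
    d * (R + s * Q) + (c + r * R)     ∎
    where
    d = s + - r
    Q = eval (quotient f r) s
    R = eval f r
    -- the ring solver cannot cancel r against − r, so s − r is kept as an atom
    s≡[s-r]+r : s ≡ d + r
    s≡[s-r]+r = sym (trans (+-assoc s (- r) r) (trans (cong (s +_) (-‿inverseˡ r)) (+-identityʳ s)))

  root⇒IsZero-quotient⇒IsZero : ∀ f r → eval f r ≡ 0# → IsZero (quotient f r) → IsZero f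
  root⇒IsZero-quotient⇒IsZero []              r _       _ = []
  root⇒IsZero-quotient⇒IsZero (c ∷ [])        r c+r0≡0 _ = trans (sym (c+x*0≡c c r)) c+r0≡0 ∷ []
  root⇒IsZero-quotient⇒IsZero (c ∷ f@(_ ∷ _)) r cf[r]≡0 (f[r]≡0 ∷ q≡0) =
    trans (sym (trans (cong (λ z → c + r * z) f[r]≡0) (c+x*0≡c c r))) cf[r]≡0
    ∷ root⇒IsZero-quotient⇒IsZero f r f[r]≡0 q≡0

  many-roots⇒IsZero : ∀ f rs → Unique rs → All (λ r → eval f r ≡ 0#) rs → length f ≤ length rs → IsZero f
  many-roots⇒IsZero []      rs       _             _              _     = []
  many-roots⇒IsZero (_ ∷ _) []       _             _              ()
  many-roots⇒IsZero f       (r ∷ rs) (r∉rs ∷ uniq) (f[r]≡0 ∷ roots) f≤r∷rs =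
    root⇒IsZero-quotient⇒IsZero f r f[r]≡0
      (many-roots⇒IsZero (quotient f r) rs uniq (All.zipWith quotient-root (r∉rs , roots))
        (subst (_≤ length rs) (sym (length-quotient f r)) (ℕₚ.pred-mono-≤ f≤r∷rs)))
    where
    quotient-root : ∀ {s} → r ≢ s × eval f s ≡ 0# → eval (quotient f r) s ≡ 0#
    quotient-root {s} (r≢s , f[s]≡0) = *-cancelˡ (s + - r) (λ s-r≡0 → r≢s (sym (x-y≡0⇒x≡y s-r≡0))) (begin
      (s + - r) * eval (quotient f r) s        ≡⟨ +-identityʳ _ ⟨
      (s + - r) * eval (quotient f r) s + 0#   ≡⟨ cong ((s + - r) * eval (quotient f r) s +_) f[r]≡0 ⟨
      (s + - r) * eval (quotient f r) s + eval f r ≡⟨ eval-quotient f r s ⟨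
      eval f s                                 ≡⟨ f[s]≡0 ⟩
      0#                                       ≡⟨ zeroʳ _ ⟨
      (s + - r) * 0#                           ∎)

  monomial : ℕ → List Carrier
  monomial zero    = 1# ∷ []
  monomial (suc k) = 0# ∷ monomial k

  eval-monomial : ∀ k x → eval (monomial k) x ≡ x ^' k
  eval-monomial zero    x = c+x*0≡c 1# x
  eval-monomial (suc k) x = trans (+-identityˡ _) (cong (x *_) (eval-monomial k x))

  length-monomial : ∀ k → length (monomial k) ≡ suc k
  length-monomial zero    = refl
  length-monomial (suc k) = cong suc (length-monomial k)

  ¬IsZero-monomial : ∀ k → ¬ IsZero (monomial k)
  ¬IsZero-monomial zero    (1≡0 ∷ []) = 1≢0 1≡0
  ¬IsZero-monomial (suc k) (_ ∷ z)    = ¬IsZero-monomial k z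

  roots-of-unity-bound : ∀ k (rs : List Carrier) → Unique rs → All (λ r → r ^' suc k ≡ 1#) rs → length rs ≤ suc k
  roots-of-unity-bound k rs uniq roots = ℕₚ.≮⇒≥ λ k+1<|rs| → ¬IsZero-monomial k (tail-IsZero
    (many-roots⇒IsZero Xᵏ⁺¹-1 rs uniq (All.map root roots)
      (subst (_≤ length rs) (sym (cong suc (length-monomial k))) k+1<|rs|)))
    where
    Xᵏ⁺¹-1 = - 1# ∷ monomial k
    root : ∀ {r} → r ^' suc k ≡ 1# → eval Xᵏ⁺¹-1 r ≡ 0#
    root {r} rᵏ⁺¹≡1 = trans (cong (λ z → - 1# + r * z) (eval-monomial k r))
      (trans (cong (- 1# +_) rᵏ⁺¹≡1) (-‿inverseˡ 1#))
    tail-IsZero : IsZero Xᵏ⁺¹-1 → IsZero (monomial k)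
    tail-IsZero (_ ∷ z) = z

module Expansions {p n : ℕ} (𝔽 : FiniteField p n) (p-prime : Prime p) where
  open PrimeSubfield 𝔽 p-prime
  open Digits p public
  open ≡-Reasoning

  -- FF.ξ generalised to families of any length: FF.ξ β x unfolds to ξ β x.
  ξ : ∀ {d} → (Fin d → Carrier) → ℕ → Carrier
  ξ v x = sumF (λ i → digit x (toℕ i) · v i)

  digit-+ : ∀ y t i z → digit (y ℕ.+ t) i · z ≡ digit y i · z + digit t i · z + carry y t i · z
  digit-+ y t i z = begin
    ((y ℕ.+ t) / pⁱ % p) · z                            ≡⟨ ·-mod ((y ℕ.+ t) / pⁱ) z ⟨
    ((y ℕ.+ t) / pⁱ) · z                                ≡⟨ cong (_· z) ([y+t]/pⁱ≡carry+[y/pⁱ+t/pⁱ] y t i) ⟩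
    (carry y t i ℕ.+ (y / pⁱ ℕ.+ t / pⁱ)) · z          ≡⟨ ·-homo-+ (carry y t i) _ z ⟩
    carry y t i · z + (y / pⁱ ℕ.+ t / pⁱ) · z          ≡⟨ cong (carry y t i · z +_) (·-homo-+ (y / pⁱ) (t / pⁱ) z) ⟩
    carry y t i · z + ((y / pⁱ) · z + (t / pⁱ) · z)
      ≡⟨ cong (carry y t i · z +_) (cong₂ _+_ (·-mod (y / pⁱ) z) (·-mod (t / pⁱ) z)) ⟩
    carry y t i · z + (digit y i · z + digit t i · z)  ≡⟨ +-comm _ _ ⟩
    digit y i · z + digit t i · z + carry y t i · z    ∎
    where
    instance _ = ℕₚ.m^n≢0 p i
    pⁱ = p ^ i

  ξ-+ : ∀ {d} (v : Fin d → Carrier) y t →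
    ξ v (y ℕ.+ t) ≡ ξ v y + ξ v t + sumF (λ i → carry y t (toℕ i) · v i)
  ξ-+ v y t = begin
    ξ v (y ℕ.+ t)                                  ≡⟨ sumF-cong (λ i → digit-+ y t (toℕ i) (v i)) ⟩
    sumF (λ i → Y i + Tt i + C i)                   ≡⟨ sumF-homo-+ (λ i → Y i + Tt i) C ⟩
    sumF (λ i → Y i + Tt i) + sumF C                ≡⟨ cong (_+ sumF C) (sumF-homo-+ Y Tt) ⟩
    ξ v y + ξ v t + sumF C                        ∎
    where
    Y Tt C : Fin _ → Carrier
    Y  i = digit y (toℕ i) · v i
    Tt i = digit t (toℕ i) · v i
    C  i = carry y t (toℕ i) · v i

  ξ-injective : ∀ {d} (v : Fin d → Carrier) → Independent v →
    ∀ {x y} → x < p ^ d → y < p ^ d → ξ v x ≡ ξ v y → x ≡ y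
  ξ-injective {d} v v-independent {x} {y} x<pᵈ y<pᵈ ξx≡ξy = digits-injective d x<pᵈ y<pᵈ λ i →
    [a+[p∸b]]%p≡0⇒a≡b (digit x (toℕ i)) (digit y (toℕ i)) (digit<p x (toℕ i)) (digit<p y (toℕ i))
      (trans (sym (Finₚ.toℕ-fromℕ< (m%n<n _ p))) (v-independent difference lincomb≡0 i))
    where
    difference : Fin d → Fin p
    difference i = (digit x (toℕ i) ℕ.+ (p ∸ digit y (toℕ i))) mod p
    term : ∀ i → toℕ (difference i) · v i ≡ digit x (toℕ i) · v i + - (digit y (toℕ i) · v i)
    term i = begin
      toℕ (difference i) · v i                       ≡⟨ cong (_· v i) (Finₚ.toℕ-fromℕ< (m%n<n _ p)) ⟩
      ((dx ℕ.+ (p ∸ dy)) % p) · v i                  ≡⟨ ·-mod (dx ℕ.+ (p ∸ dy)) (v i) ⟨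
      (dx ℕ.+ (p ∸ dy)) · v i                        ≡⟨ ·-homo-+ dx (p ∸ dy) (v i) ⟩
      dx · v i + (p ∸ dy) · v i
        ≡⟨ cong (dx · v i +_) (-[a·x]≡[p∸a]·x dy (v i) (ℕₚ.<⇒≤ (digit<p y (toℕ i)))) ⟨
      dx · v i + - (dy · v i)                        ∎
      where
      dx = digit x (toℕ i)
      dy = digit y (toℕ i)
    lincomb≡0 : lincomb difference v ≡ 0#
    lincomb≡0 = begin
      lincomb difference v              ≡⟨ sumF-cong term ⟩
      sumF (λ i → X i + - Y i)          ≡⟨ sumF-homo-+ X (λ i → - Y i) ⟩
      ξ v x + sumF (λ i → - Y i)        ≡⟨ cong (ξ v x +_) (sumF-neg Y) ⟩
      ξ v x + - ξ v y                   ≡⟨ cong (_+ - ξ v y) ξx≡ξy ⟩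
      ξ v y + - ξ v y                   ≡⟨ -‿inverseʳ _ ⟩
      0#                                ∎
      where
      X Y : Fin d → Carrier
      X i = digit x (toℕ i) · v i
      Y i = digit y (toℕ i) · v i

module CyclicSubgroup {p n : ℕ} (𝔽 : FiniteField p n) (γ : FF.Carrier 𝔽) (T : ℕ) (γ-order : FF.HasOrder 𝔽 γ T) where
  open FieldProperties 𝔽
  open Polynomials 𝔽 using (roots-of-unity-bound)
  open ≡-Reasoning

  private
    1≤T : 1 ≤ T
    1≤T = proj₁ γ-order
    γᵀ≡1 : γ ^' T ≡ 1#
    γᵀ≡1 = proj₁ (proj₂ γ-order)
    γᵗ≢1 : ∀ t → 1 ≤ t → t < T → γ ^' t ≢ 1#
    γᵗ≢1 = proj₂ (proj₂ γ-order)

  [γˣ]ᵀ≡1 : ∀ x → (γ ^' x) ^' T ≡ 1#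
  [γˣ]ᵀ≡1 x = begin
    (γ ^' x) ^' T     ≡⟨ ^'-assocʳ γ x T ⟩
    γ ^' (x ℕ.* T)    ≡⟨ cong (γ ^'_) (ℕₚ.*-comm x T) ⟩
    γ ^' (T ℕ.* x)    ≡⟨ ^'-assocʳ γ T x ⟨
    (γ ^' T) ^' x     ≡⟨ cong (_^' x) γᵀ≡1 ⟩
    1# ^' x           ≡⟨ 1^'a≡1 x ⟩
    1#                ∎

  γˣ≢0 : ∀ x → γ ^' x ≢ 0#
  γˣ≢0 x γˣ≡0 = 1≢0 (begin
    1#                    ≡⟨ [γˣ]ᵀ≡1 x ⟨
    (γ ^' x) ^' T         ≡⟨ cong (_^' T) γˣ≡0 ⟩
    0# ^' T               ≡⟨ cong (0# ^'_) (ℕₚ.suc-pred T {{ℕ.>-nonZero 1≤T}}) ⟨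
    0# * 0# ^' ℕ.pred T   ≡⟨ zeroˡ _ ⟩
    0#                    ∎)

  x<y⇒γˣ≢γʸ : ∀ {x y} → x < y → y < T → γ ^' x ≢ γ ^' y
  x<y⇒γˣ≢γʸ {x} {y} x<y y<T γˣ≡γʸ = γᵗ≢1 (y ∸ x) (ℕₚ.m<n⇒0<n∸m x<y) (ℕₚ.≤-<-trans (ℕₚ.m∸n≤m y x) y<T)
    (sym (*-cancelˡ (γ ^' x) (γˣ≢0 x) (begin
      γ ^' x * 1#                ≡⟨ *-identityʳ _ ⟩
      γ ^' x                     ≡⟨ γˣ≡γʸ ⟩
      γ ^' y                     ≡⟨ cong (γ ^'_) (ℕₚ.m+[n∸m]≡n (ℕₚ.<⇒≤ x<y)) ⟨
      γ ^' (x ℕ.+ (y ∸ x))       ≡⟨ ^'-homo-* γ x (y ∸ x) ⟩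
      γ ^' x * γ ^' (y ∸ x)      ∎)))

  γˣ-injective : ∀ {x y} → x < T → y < T → γ ^' x ≡ γ ^' y → x ≡ y
  γˣ-injective {x} {y} x<T y<T γˣ≡γʸ with ℕₚ.<-cmp x y
  ... | tri< x<y _ _ = ⊥-elim (x<y⇒γˣ≢γʸ x<y y<T γˣ≡γʸ)
  ... | tri≈ _ x≡y _ = x≡y
  ... | tri> _ _ y<x = ⊥-elim (x<y⇒γˣ≢γʸ y<x x<T (sym γˣ≡γʸ))

  T≤pⁿ : T ≤ p ^ n
  T≤pⁿ = Finₚ.injective⇒≤ {f = λ i → Inverse.to enum (γ ^' toℕ i)}
    (λ {i} {j} eq → Finₚ.toℕ-injective (γˣ-injective (Finₚ.toℕ<n i) (Finₚ.toℕ<n j) (enum-injective eq)))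

  -- G contains T roots of X^T − 1, hence all of them.
  root-of-unity⇒∈G : ∀ ζ → ζ ^' T ≡ 1# → ∃ λ s → s < T × γ ^' s ≡ ζ
  root-of-unity⇒∈G ζ ζᵀ≡1 with Finₚ.any? {n = T} (λ i → (γ ^' toℕ i) ≟ ζ)
  ... | yes (i , γⁱ≡ζ) = toℕ i , Finₚ.toℕ<n i , γⁱ≡ζ
  ... | no  ζ∉G = ⊥-elim (ℕₚ.<⇒≱ T<|roots| (subst (length roots ≤_) (sym T≡1+pred)
          (roots-of-unity-bound (ℕ.pred T) roots uniq
            (All.map (subst (λ e → _ ^' e ≡ 1#) T≡1+pred)
              (ζᵀ≡1 ∷ AllP.tabulate⁺ (λ i → [γˣ]ᵀ≡1 (toℕ i)))))))
    where
    T≡1+pred : T ≡ suc (ℕ.pred T)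
    T≡1+pred = sym (ℕₚ.suc-pred T {{ℕ.>-nonZero 1≤T}})
    roots = ζ ∷ List.tabulate (λ (i : Fin T) → γ ^' toℕ i)
    T<|roots| : T < length roots
    T<|roots| = s≤s (ℕₚ.≤-reflexive (sym (Listₚ.length-tabulate _)))
    uniq : Unique roots
    uniq = AllP.tabulate⁺ (λ i γⁱ≡ζ → ζ∉G (i , sym γⁱ≡ζ))
         ∷ UniqP.tabulate⁺ (λ {i} {j} eq → Finₚ.toℕ-injective (γˣ-injective (Finₚ.toℕ<n i) (Finₚ.toℕ<n j) eq))

module PrimeFieldRootsOfUnity {p n : ℕ} (𝔽 : FiniteField p n) (p-prime : Prime p) where
  open PrimeSubfield 𝔽 p-prime
  open Polynomials 𝔽 using (roots-of-unity-bound)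
  open ≡-Reasoning

  fermat-unit : ∀ a → a · 1# ≢ 0# → (a · 1#) ^' (p ∸ 1) ≡ 1#
  fermat-unit a a·1≢0 = sym (*-cancelˡ (a · 1#) a·1≢0 (begin
    (a · 1#) * 1#                  ≡⟨ *-identityʳ _ ⟩
    a · 1#                         ≡⟨ fermat a ⟨
    (a · 1#) ^' p                  ≡⟨ cong ((a · 1#) ^'_) (ℕₚ.suc-pred p) ⟨
    (a · 1#) * (a · 1#) ^' (p ∸ 1) ∎))

  unit : Fin (p ∸ 1) → Carrier
  unit i = suc (toℕ i) · 1#

  unit<p : ∀ i → suc (toℕ i) < p
  unit<p i = ℕₚ.<-≤-trans (s≤s (Finₚ.toℕ<n i)) (ℕₚ.≤-reflexive (ℕₚ.suc-pred p))

  -- 𝔽ₚ has p − 1 > e + 1 units, but X^(e+1) − 1 has at most e + 1 roots.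
  non-root : ∀ e → suc e < p ∸ 1 → ∃ λ a → 0 < a × a < p × (a · 1#) ^' suc e ≢ 1#
  non-root e e+1<p-1 with Finₚ.any? {n = p ∸ 1} (λ i → ¬? ((unit i ^' suc e) ≟ 1#))
  ... | yes (i , ≢1)  = suc (toℕ i) , s≤s z≤n , unit<p i , ≢1
  ... | no  all-roots = ⊥-elim (ℕₚ.<⇒≱ e+1<p-1 (subst (_≤ suc e) (Listₚ.length-tabulate unit)
          (roots-of-unity-bound e (List.tabulate unit) uniq (AllP.tabulate⁺ root))))
    where
    uniq : Unique (List.tabulate unit)
    uniq = UniqP.tabulate⁺ λ {i} {j} eq →
      Finₚ.toℕ-injective (ℕₚ.suc-injective (·1-injective (unit<p i) (unit<p j) eq))
    root : ∀ i → unit i ^' suc e ≡ 1#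
    root i = decidable-stable ((unit i ^' suc e) ≟ 1#) (λ ≢1 → all-roots (i , ≢1))

  nontrivial-root-of-unity : ∀ T → 1 < gcd T (p ∸ 1) → ∃ λ r → r · 1# ≢ 1# × (r · 1#) ^' T ≡ 1#
  nontrivial-root-of-unity T 1<g with gcd[m,n]∣n T (p ∸ 1) | gcd[m,n]∣m T (p ∸ 1)
  ... | divides zero    p-1≡0       | _ = ⊥-elim (ℕₚ.<⇒≢ (ℕₚ.m<n⇒0<n∸m (prime>1 p-prime)) (sym p-1≡0))
  ... | divides (suc e) p-1≡[1+e]*g | divides q T≡q*g
    with non-root e (subst (suc e <_) (sym p-1≡[1+e]*g) (ℕₚ.m<m*n (suc e) (gcd T (p ∸ 1)) 1<g))
  ...   | a , 0<a , a<p , ≢1 = a ^ suc e , (λ eq → ≢1 (trans (sym (·1-homo-^ a (suc e))) eq)) , (begin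
    ((a ^ suc e) · 1#) ^' T              ≡⟨ cong (_^' T) (·1-homo-^ a (suc e)) ⟩
    ((a · 1#) ^' suc e) ^' T             ≡⟨ ^'-assocʳ (a · 1#) (suc e) T ⟩
    (a · 1#) ^' (suc e ℕ.* T)            ≡⟨ cong (λ t → (a · 1#) ^' (suc e ℕ.* t)) T≡q*g ⟩
    (a · 1#) ^' (suc e ℕ.* (q ℕ.* g))    ≡⟨ cong ((a · 1#) ^'_) (regroup (suc e) q g) ⟩
    (a · 1#) ^' ((suc e ℕ.* g) ℕ.* q)    ≡⟨ ^'-assocʳ (a · 1#) (suc e ℕ.* g) q ⟨
    ((a · 1#) ^' (suc e ℕ.* g)) ^' q     ≡⟨ cong (λ t → ((a · 1#) ^' t) ^' q) p-1≡[1+e]*g ⟨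
    ((a · 1#) ^' (p ∸ 1)) ^' q           ≡⟨ cong (_^' q) (fermat-unit a (a·1≢0 a 0<a a<p)) ⟩
    1# ^' q                              ≡⟨ 1^'a≡1 q ⟩
    1#                                   ∎)
    where
    g = gcd T (p ∸ 1)
    regroup : ∀ e q g → e ℕ.* (q ℕ.* g) ≡ e ℕ.* g ℕ.* q
    regroup = solve-∀

-- Multiplication by γˢ on the exponents

module Shift {p n′ : ℕ} (𝔽 : FiniteField p (suc n′)) (p-prime : Prime p)
  (γ : FF.Carrier 𝔽) (T : ℕ) (γ-order : FF.HasOrder 𝔽 γ T) (β : Fin (suc n′) → FF.Carrier 𝔽)
  (s : ℕ) (s<T : s < T) where
  open PrimeSubfield 𝔽 p-prime
  open Expansions 𝔽 p-prime using (ξ; ξ-+; carry; carry<2; carry-0)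
  open CyclicSubgroup 𝔽 γ T γ-order using (γˣ-injective; γˣ≢0)
  open ≡-Reasoning

  shift : ℕ → ℕ
  shift x with x ℕ.+ s ℕ.<? T
  ... | yes _ = x ℕ.+ s
  ... | no  _ = x ℕ.+ s ∸ T

  shift<T : ∀ {x} → x < T → shift x < T
  shift<T {x} x<T with x ℕ.+ s ℕ.<? T
  ... | yes x+s<T = x+s<T
  ... | no  _     = ℕₚ.m<n+o⇒m∸n<o (x ℕ.+ s) T {{ℕ.>-nonZero (ℕₚ.≤-<-trans z≤n s<T)}} (ℕₚ.+-mono-< x<T s<T)

  γ^shift : ∀ x → γ ^' shift x ≡ γ ^' s * γ ^' x
  γ^shift x with x ℕ.+ s ℕ.<? T
  ... | yes _ = trans (^'-homo-* γ x s) (*-comm _ _)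
  ... | no  ¬x+s<T = begin
    γ ^' (x ℕ.+ s ∸ T)                  ≡⟨ *-identityʳ _ ⟨
    γ ^' (x ℕ.+ s ∸ T) * 1#             ≡⟨ cong (γ ^' (x ℕ.+ s ∸ T) *_) (proj₁ (proj₂ γ-order)) ⟨
    γ ^' (x ℕ.+ s ∸ T) * γ ^' T         ≡⟨ ^'-homo-* γ (x ℕ.+ s ∸ T) T ⟨
    γ ^' (x ℕ.+ s ∸ T ℕ.+ T)            ≡⟨ cong (γ ^'_) (ℕₚ.m∸n+n≡m (ℕₚ.≮⇒≥ ¬x+s<T)) ⟩
    γ ^' (x ℕ.+ s)                      ≡⟨ ^'-homo-* γ x s ⟩
    γ ^' x * γ ^' s                     ≡⟨ *-comm _ _ ⟩
    γ ^' s * γ ^' x                     ∎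

  shift-injective : ∀ {x y} → x < T → y < T → shift x ≡ shift y → x ≡ y
  shift-injective {x} {y} x<T y<T eq = γˣ-injective x<T y<T (*-cancelˡ (γ ^' s) (γˣ≢0 s)
    (trans (sym (γ^shift x)) (trans (cong (γ ^'_) eq) (γ^shift y))))

  -- Bit 0 records whether x + s wraps around T, bit i > 0 is the carry into digit i of the base-p
  -- addition performed; no carry enters digit 0, which frees bit 0 for the wrap flag.
  Signature : Set
  Signature = Fin (suc n′) → Fin 2

  carryBits : Fin 2 → ℕ → ℕ → Signature
  carryBits wrap y t Fin.zero    = wrap
  carryBits wrap y t (Fin.suc i) = Fin.fromℕ< (carry<2 y t (suc (toℕ i)))

  signature : ℕ → Signature
  signature x with x ℕ.+ s ℕ.<? T
  ... | yes _ = carryBits Fin.zero x s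
  ... | no  _ = carryBits (Fin.suc Fin.zero) (x ℕ.+ s ∸ T) (T ∸ s)

  carrySum : Signature → Carrier
  carrySum b = sumF (λ i → toℕ (b (Fin.suc i)) · β (Fin.suc i))

  Φ : Signature → Carrier
  Φ b with b Fin.zero
  ... | Fin.zero  = ξ β s + carrySum b
  ... | Fin.suc _ = - (ξ β (T ∸ s) + carrySum b)

  carrySum-cong : ∀ {b b′} → (∀ i → b i ≡ b′ i) → carrySum b ≡ carrySum b′
  carrySum-cong b≗b′ = sumF-cong (λ i → cong (λ z → toℕ z · β (Fin.suc i)) (b≗b′ (Fin.suc i)))

  Φ-cong : ∀ {b b′} → (∀ i → b i ≡ b′ i) → Φ b ≡ Φ b′
  Φ-cong {b} {b′} b≗b′ with b Fin.zero | b′ Fin.zero | b≗b′ Fin.zero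
  ... | Fin.zero  | .Fin.zero    | refl = cong (ξ β s +_) (carrySum-cong b≗b′)
  ... | Fin.suc _ | .(Fin.suc _) | refl = cong (λ z → - (ξ β (T ∸ s) + z)) (carrySum-cong b≗b′)

  carries≡carrySum : ∀ wrap y t → sumF (λ i → carry y t (toℕ i) · β i) ≡ carrySum (carryBits wrap y t)
  carries≡carrySum wrap y t = begin
    carry y t 0 · β Fin.zero + carrySum′   ≡⟨ cong (λ c → c · β Fin.zero + carrySum′) (carry-0 y t) ⟩
    0# + carrySum′                         ≡⟨ +-identityˡ _ ⟩
    carrySum′                              ≡⟨ sumF-cong (λ i → cong (_· β (Fin.suc i)) (bit≡carry i)) ⟨
    carrySum (carryBits wrap y t)          ∎
    where
    carrySum′ = sumF (λ i → carry y t (suc (toℕ i)) · β (Fin.suc i))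
    bit≡carry : ∀ i → toℕ (carryBits wrap y t (Fin.suc i)) ≡ carry y t (suc (toℕ i))
    bit≡carry i = Finₚ.toℕ-fromℕ< (carry<2 y t (suc (toℕ i)))

  ξ-shift : ∀ x → ξ β (shift x) ≡ ξ β x + Φ (signature x)
  ξ-shift x with x ℕ.+ s ℕ.<? T
  ... | yes _ = begin
    ξ β (x ℕ.+ s)                                         ≡⟨ ξ-+ β x s ⟩
    ξ β x + ξ β s + sumF (λ i → carry x s (toℕ i) · β i)  ≡⟨ cong (ξ β x + ξ β s +_) (carries≡carrySum Fin.zero x s) ⟩
    ξ β x + ξ β s + carrySum (carryBits Fin.zero x s)     ≡⟨ +-assoc _ _ _ ⟩
    ξ β x + (ξ β s + carrySum (carryBits Fin.zero x s))   ∎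
  ... | no ¬x+s<T = x≡y+z⇒y≡x-z ξx≡ξy+D
    where
    y = x ℕ.+ s ∸ T
    D = ξ β (T ∸ s) + carrySum (carryBits (Fin.suc Fin.zero) y (T ∸ s))
    y+[T∸s]≡x : y ℕ.+ (T ∸ s) ≡ x
    y+[T∸s]≡x = ℕₚ.+-cancelʳ-≡ s _ _ (begin
      y ℕ.+ (T ∸ s) ℕ.+ s          ≡⟨ ℕₚ.+-assoc y (T ∸ s) s ⟩
      y ℕ.+ (T ∸ s ℕ.+ s)          ≡⟨ cong (y ℕ.+_) (ℕₚ.m∸n+n≡m (ℕₚ.<⇒≤ s<T)) ⟩
      y ℕ.+ T                      ≡⟨ ℕₚ.m∸n+n≡m (ℕₚ.≮⇒≥ ¬x+s<T) ⟩
      x ℕ.+ s                      ∎)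
    ξx≡ξy+D : ξ β x ≡ ξ β y + D
    ξx≡ξy+D = begin
      ξ β x                                                              ≡⟨ cong (ξ β) y+[T∸s]≡x ⟨
      ξ β (y ℕ.+ (T ∸ s))                                                ≡⟨ ξ-+ β y (T ∸ s) ⟩
      ξ β y + ξ β (T ∸ s) + sumF (λ i → carry y (T ∸ s) (toℕ i) · β i)
        ≡⟨ cong (ξ β y + ξ β (T ∸ s) +_) (carries≡carrySum (Fin.suc Fin.zero) y (T ∸ s)) ⟩
      ξ β y + ξ β (T ∸ s) + carrySum (carryBits (Fin.suc Fin.zero) y (T ∸ s)) ≡⟨ +-assoc _ _ _ ⟩
      ξ β y + D                                                          ∎

module SubspaceProperties {p n : ℕ} (𝔽 : FiniteField p n) (p-prime : Prime p)
  {U : FF.Carrier 𝔽 → Set} {d : ℕ} (U-subspace : FF.Subspace 𝔽 U d) where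
  open PrimeSubfield 𝔽 p-prime
  open Expansions 𝔽 p-prime using (ξ; digit)
  open Subspace U-subspace

  ∈-scale : ∀ r {z} → U z → U ((r · 1#) * z)
  ∈-scale r {z} z∈U = subst U (·≡·1* r z) (·∈ r z∈U)

  ∈-neg : ∀ {z} → U z → U (- z)
  ∈-neg {z} z∈U = subst U (trans (sym (-[a·x]≡[p∸a]·x 1 z (ℕₚ.<⇒≤ (prime>1 p-prime)))) (cong -_ (+-identityʳ z)))
    (·∈ (p ∸ 1) z∈U)

  ∈-sum : ∀ {e} (f : Fin e → ℕ) (w : Fin e → Carrier) → (∀ i → U (w i)) → U (sumF (λ i → f i · w i))
  ∈-sum {zero}  f w w∈U = zero∈
  ∈-sum {suc e} f w w∈U = +∈ (·∈ (f Fin.zero) (w∈U Fin.zero)) (∈-sum (f ∘ Fin.suc) (w ∘ Fin.suc) (w∈U ∘ Fin.suc))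

  ξ[basis]∈U : ∀ j → U (ξ basis j)
  ξ[basis]∈U j = ∈-sum (λ i → digit j (toℕ i)) basis basis∈

module Bound {p n′ : ℕ} (𝔽 : FiniteField p (suc n′)) (p-prime : Prime p)
  (γ : FF.Carrier 𝔽) (T : ℕ) (γ-order : FF.HasOrder 𝔽 γ T)
  (β : Fin (suc n′) → FF.Carrier 𝔽) (β-basis : FF.IsBasis 𝔽 β)
  (F : FF.Carrier 𝔽 → FF.Carrier 𝔽)
  {U : FF.Carrier 𝔽 → Set} {d : ℕ} (U-subspace : FF.Subspace 𝔽 U d)
  (M : Fin (suc n′) → FF.Carrier 𝔽) (a : FF.Carrier 𝔽 → FF.Carrier 𝔽)
  (a-const : ∀ ζ ζ′ → U (FF._+_ 𝔽 ζ (FF.-_ 𝔽 ζ′)) → a ζ ≡ a ζ′)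
  (F≡M+a : ∀ ζ → F ζ ≡ FF._+_ 𝔽 (FF.linearised 𝔽 M ζ) (a ζ))
  (1<gcd : 1 < gcd T (p ∸ 1)) where
  open PrimeSubfield 𝔽 p-prime
  open Expansions 𝔽 p-prime using (ξ; ξ-injective)
  open CyclicSubgroup 𝔽 γ T γ-order using (root-of-unity⇒∈G; T≤pⁿ)
  open PrimeFieldRootsOfUnity 𝔽 p-prime using (nontrivial-root-of-unity)
  open SubspaceProperties 𝔽 p-prime U-subspace using (∈-scale; ∈-neg; ξ[basis]∈U)
  open Subspace U-subspace using (+∈; basis; basisIndep)

  private
    c-root = nontrivial-root-of-unity T 1<gcd
    c∈G = root-of-unity⇒∈G (proj₁ c-root · 1#) (proj₂ (proj₂ c-root))

  r : ℕ
  r = proj₁ c-root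

  c : Carrier
  c = r · 1#

  c≢1 : c ≢ 1#
  c≢1 = proj₁ (proj₂ c-root)

  s : ℕ
  s = proj₁ c∈G

  s<T : s < T
  s<T = proj₁ (proj₂ c∈G)

  γˢ≡c : γ ^' s ≡ c
  γˢ≡c = proj₂ (proj₂ c∈G)

  open Shift 𝔽 p-prime γ T γ-order β s s<T

  Correct : ℕ → Set
  Correct x = F (γ ^' x) ≡ ξ β x

  W : Carrier → Carrier
  W ζ = a (c * ζ) + - (c * a ζ)

  W-coset : ∀ {ζ ζ′} → U (ζ + - ζ′) → W ζ ≡ W ζ′
  W-coset {ζ} {ζ′} ζ-ζ′∈U = cong₂ (λ u v → u + - (c * v))
    (a-const _ _ (subst U (x[y-z]≈xy-xz c ζ ζ′) (∈-scale r ζ-ζ′∈U))) (a-const _ _ ζ-ζ′∈U)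

  W≡F[cζ]-cF[ζ] : ∀ ζ → W ζ ≡ F (c * ζ) + - (c * F ζ)
  W≡F[cζ]-cF[ζ] ζ = sym (begin
    F (c * ζ) + - (c * F ζ)                 ≡⟨ cong₂ (λ u v → u + - (c * v)) (F≡M+a (c * ζ)) (F≡M+a ζ) ⟩
    L (c * ζ) + A + - (c * (L ζ + a ζ))     ≡⟨ cong (λ u → u + A + - (c * (L ζ + a ζ))) (linearised-homogeneous M r ζ) ⟩
    cL + A + - (c * (L ζ + a ζ))            ≡⟨ cong (λ u → cL + A + - u) (distribˡ c (L ζ) (a ζ)) ⟩
    cL + A + - (cL + cB)                    ≡⟨ cong (cL + A +_) (-‿+-comm cL cB) ⟨
    cL + A + (- cL + - cB)
      ≡⟨ solve 4 (λ x A y B → ((x ⊕ A) ⊕ (y ⊕ B)) ⊜ ((x ⊕ y) ⊕ (A ⊕ B))) refl cL A (- cL) (- cB) ⟩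
    (cL + - cL) + (A + - cB)                ≡⟨ cong (_+ (A + - cB)) (-‿inverseʳ cL) ⟩
    0# + (A + - cB)                         ≡⟨ +-identityˡ _ ⟩
    A + - cB                                ∎)
    where
    open ≡-Reasoning
    L = linearised M
    cL = c * L ζ
    cB = c * a ζ
    A = a (c * ζ)

  W[γˣ]≡[1-c]ξ+Φ : ∀ x → Correct x → Correct (shift x) → W (γ ^' x) ≡ (1# + - c) * ξ β x + Φ (signature x)
  W[γˣ]≡[1-c]ξ+Φ x correct-x correct-shift = begin
    W (γ ^' x)                                ≡⟨ W≡F[cζ]-cF[ζ] (γ ^' x) ⟩
    F (c * γ ^' x) + - (c * F (γ ^' x))       ≡⟨ cong₂ (λ u v → u + - (c * v)) F[cγˣ]≡ξ[shift] correct-x ⟩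
    ξ β (shift x) + - (c * ξ β x)             ≡⟨ cong (_+ - (c * ξ β x)) (ξ-shift x) ⟩
    ξ β x + Φ (signature x) + - (c * ξ β x)   ≡⟨ solve 3 (λ X P N → ((X ⊕ P) ⊕ N) ⊜ ((X ⊕ N) ⊕ P)) refl (ξ β x) _ _ ⟩
    ξ β x + - (c * ξ β x) + Φ (signature x)   ≡⟨ cong (_+ Φ (signature x)) [1-c]X ⟨
    (1# + - c) * ξ β x + Φ (signature x)      ∎
    where
    open ≡-Reasoning
    F[cγˣ]≡ξ[shift] : F (c * γ ^' x) ≡ ξ β (shift x)
    F[cγˣ]≡ξ[shift] = trans (cong F (trans (cong (_* γ ^' x) (sym γˢ≡c)) (sym (γ^shift x)))) correct-shift
    [1-c]X : (1# + - c) * ξ β x ≡ ξ β x + - (c * ξ β x)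
    [1-c]X = trans (distribʳ (ξ β x) 1# (- c)) (cong₂ _+_ (*-identityˡ _) (sym (-‿distribˡ-* c (ξ β x))))

  same-signature-and-coset⇒≡ : ∀ {x y} → x < T → y < T →
    Correct x → Correct (shift x) → Correct y → Correct (shift y) →
    (∀ i → signature x i ≡ signature y i) → U (γ ^' x + - (γ ^' y)) → x ≡ y
  same-signature-and-coset⇒≡ {x} {y} x<T y<T cx csx cy csy σx≗σy γˣ-γʸ∈U =
    ξ-injective β (proj₁ β-basis) (ℕₚ.<-≤-trans x<T T≤pⁿ) (ℕₚ.<-≤-trans y<T T≤pⁿ)
      (*-cancelˡ (1# + - c) (λ 1-c≡0 → c≢1 (sym (x-y≡0⇒x≡y 1-c≡0)))
        (+-cancelʳ (Φ (signature x)) _ _ (begin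
          (1# + - c) * ξ β x + Φ (signature x)   ≡⟨ W[γˣ]≡[1-c]ξ+Φ x cx csx ⟨
          W (γ ^' x)                             ≡⟨ W-coset γˣ-γʸ∈U ⟩
          W (γ ^' y)                             ≡⟨ W[γˣ]≡[1-c]ξ+Φ y cy csy ⟩
          (1# + - c) * ξ β y + Φ (signature y)   ≡⟨ cong ((1# + - c) * ξ β y +_) (Φ-cong σx≗σy) ⟨
          (1# + - c) * ξ β y + Φ (signature x)   ∎)))
    where open ≡-Reasoning

  shiftF : Fin T → Fin T
  shiftF i = Fin.fromℕ< (shift<T (Finₚ.toℕ<n i))

  toℕ-shiftF : ∀ i → toℕ (shiftF i) ≡ shift (toℕ i)
  toℕ-shiftF i = Finₚ.toℕ-fromℕ< (shift<T (Finₚ.toℕ<n i))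

  shiftF-injective : ∀ {i j} → shiftF i ≡ shiftF j → i ≡ j
  shiftF-injective {i} {j} eq = Finₚ.toℕ-injective (shift-injective (Finₚ.toℕ<n i) (Finₚ.toℕ<n j)
    (trans (sym (toℕ-shiftF i)) (trans (cong toℕ eq) (toℕ-shiftF j))))

  correct? : Decidable (λ (i : Fin T) → Correct (toℕ i))
  correct? i = F (γ ^' toℕ i) ≟ ξ β (toℕ i)

  Good : Pred (Fin T) 0ℓ
  Good i = Correct (toℕ i) × Correct (toℕ (shiftF i))

  good? : Decidable Good
  good? = correct? ∩? (correct? ∘ shiftF)

  -- The elements of the coset γˣ + U are the γˣ + ξ basis j with j < pᵈ.
  code : Fin T → Fin (p ^ d) → Fin (2 ^ suc n′ ℕ.* p ^ suc n′)
  code i j = Fin.combine (Fin.funToFin (signature (toℕ i))) (Inverse.to enum (γ ^' toℕ i + ξ basis (toℕ j)))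

  code-injective : ∀ {i i′ j j′} → Good i → Good i′ → code i j ≡ code i′ j′ → i ≡ i′ × j ≡ j′
  code-injective {i} {i′} {j} {j′} (cx , csx′) (cy , csy′) eq = i≡i′ , j≡j′
    where
    x = toℕ i
    y = toℕ i′
    csx = subst Correct (toℕ-shiftF i) csx′
    csy = subst Correct (toℕ-shiftF i′) csy′
    σ≡ = Finₚ.combine-injectiveˡ (Fin.funToFin (signature x)) _ (Fin.funToFin (signature y)) _ eq
    elem≡ : γ ^' x + ξ basis (toℕ j) ≡ γ ^' y + ξ basis (toℕ j′)
    elem≡ = enum-injective (Finₚ.combine-injectiveʳ (Fin.funToFin (signature x)) _ (Fin.funToFin (signature y)) _ eq)
    σx≗σy : ∀ b → signature x b ≡ signature y b
    σx≗σy b = trans (sym (Finₚ.finToFun-funToFin (signature x) b))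
      (trans (cong (λ z → Fin.finToFun z b) σ≡) (Finₚ.finToFun-funToFin (signature y) b))
    γˣ-γʸ∈U : U (γ ^' x + - (γ ^' y))
    γˣ-γʸ∈U = subst U (sym (x+u≡y+w⇒x-y≡w-u elem≡)) (+∈ (ξ[basis]∈U (toℕ j′)) (∈-neg (ξ[basis]∈U (toℕ j))))
    x≡y : x ≡ y
    x≡y = same-signature-and-coset⇒≡ (Finₚ.toℕ<n i) (Finₚ.toℕ<n i′) cx csx cy csy σx≗σy γˣ-γʸ∈U
    i≡i′ = Finₚ.toℕ-injective x≡y
    j≡j′ = Finₚ.toℕ-injective (ξ-injective basis basisIndep (Finₚ.toℕ<n j) (Finₚ.toℕ<n j′)
      (+-cancelˡ (γ ^' x) _ _ (trans elem≡ (cong (λ z → γ ^' z + ξ basis (toℕ j′)) (sym x≡y)))))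

  count-good≤ : ∀ {k} → d ℕ.+ k ≡ suc n′ → count good? (allFin T) ≤ 2 ^ suc n′ ℕ.* p ^ k
  count-good≤ {k} d+k≡n = ℕₚ.*-cancelʳ-≤ _ _ (p ^ d) {{ℕₚ.m^n≢0 p d}} (begin
    count good? (allFin T) ℕ.* p ^ d   ≤⟨ count*K≤N good? code code-injective ⟩
    2 ^ suc n′ ℕ.* p ^ suc n′          ≡⟨ cong (λ e → 2 ^ suc n′ ℕ.* p ^ e) d+k≡n ⟨
    2 ^ suc n′ ℕ.* p ^ (d ℕ.+ k)       ≡⟨ cong (2 ^ suc n′ ℕ.*_) (ℕₚ.^-distribˡ-+-* p d k) ⟩
    2 ^ suc n′ ℕ.* (p ^ d ℕ.* p ^ k)   ≡⟨ regroup (2 ^ suc n′) (p ^ d) (p ^ k) ⟩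
    2 ^ suc n′ ℕ.* p ^ k ℕ.* p ^ d     ∎)
    where
    open ℕₚ.≤-Reasoning
    regroup : ∀ a b c → a ℕ.* (b ℕ.* c) ≡ a ℕ.* c ℕ.* b
    regroup = solve-∀

  T≤mismatches+mismatches+count-good :
    T ≤ mismatches β γ T F ℕ.+ (mismatches β γ T F ℕ.+ count good? (allFin T))
  T≤mismatches+mismatches+count-good = begin
    T                                                ≡⟨ Listₚ.length-tabulate {n = T} (λ i → i) ⟨
    length (allFin T)                                ≤⟨ count-cover correct? (correct? ∘ shiftF) (allFin T) ⟩
    #bad ℕ.+ (count (∁? correct? ∘ shiftF) (allFin T) ℕ.+ #good)
      ≤⟨ ℕₚ.+-monoʳ-≤ #bad (ℕₚ.+-monoˡ-≤ #good (count-∘-injective≤ (∁? correct?) shiftF shiftF-injective)) ⟩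
    #bad ℕ.+ (#bad ℕ.+ #good)                        ∎
    where
    open ℕₚ.≤-Reasoning
    #bad = mismatches β γ T F
    #good = count good? (allFin T)

  bound : ∀ {m k} → mismatches β γ T F ≤ m → d ℕ.+ k ≡ suc n′ → T ∸ 2 ℕ.* m ≤ 2 ^ suc n′ ℕ.* p ^ k
  bound {m} {k} mismatches≤m d+k≡n = ℕₚ.≤-trans (ℕₚ.m≤n+o⇒m∸n≤o T (2 ℕ.* m) T≤2m+count) (count-good≤ d+k≡n)
    where
    regroup : ∀ m g → m ℕ.+ (m ℕ.+ g) ≡ 2 ℕ.* m ℕ.+ g
    regroup = solve-∀
    T≤2m+count : T ≤ 2 ℕ.* m ℕ.+ count good? (allFin T)
    T≤2m+count = ℕₚ.≤-trans T≤mismatches+mismatches+count-good (ℕₚ.≤-trans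
      (ℕₚ.+-mono-≤ mismatches≤m (ℕₚ.+-monoˡ-≤ (count good? (allFin T)) mismatches≤m))
      (ℕₚ.≤-reflexive (regroup m (count good? (allFin T)))))

open import Data.Nat using (_+_; _*_)

theorem4p9 : (p n : ℕ) → Prime p → .{{_ : NonZero p}} → 1 ≤ n
    → (𝔽 : FiniteField p n)
    → (γ : FF.Carrier 𝔽) (T : ℕ) → FF.HasOrder 𝔽 γ T
    → (β : Fin n → FF.Carrier 𝔽) → FF.IsBasis 𝔽 β
    → (m : ℕ) → m ≤ T
    → (F : FF.Carrier 𝔽 → FF.Carrier 𝔽) → FF.mismatches 𝔽 β γ T F ≤ m
    → (k d : ℕ) (U : FF.Carrier 𝔽 → Set) → FF.Subspace 𝔽 U d → d + k ≡ n
    → (M : Fin n → FF.Carrier 𝔽)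
    → (a : FF.Carrier 𝔽 → FF.Carrier 𝔽)
    → (∀ ζ ζ′ → U (FF._+_ 𝔽 ζ (FF.-_ 𝔽 ζ′)) → a ζ ≡ a ζ′)
    → (∀ ζ → F ζ ≡ FF._+_ 𝔽 (FF.linearised 𝔽 M ζ) (a ζ))
    → 1 < gcd T (p ∸ 1)
    → T ∸ 2 * m ≤ 2 ^ n * p ^ k
theorem4p9 p (suc n′) p-prime _ 𝔽 γ T γ-order β β-basis m _ F mismatches≤m k d U U-subspace d+k≡n
           M a a-const F≡M+a 1<gcd =
  Bound.bound 𝔽 p-prime γ T γ-order β β-basis F U-subspace M a a-const F≡M+a 1<gcd mismatches≤m d+k≡n
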